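{- For $n\ge1$, the number of inversion sequences $e\in\mathbf{I}_n$ with no index $i$ such that $e_i\le e_{i+1}>e_{i+2}$ equals the Catalan number $C_n=\frac{1}{n+1}\binom{2n}{n}$.
   Context: An inversion sequence of length $n$ is an integer sequence $e=e_1\dots e_n$ with $0\le e_i<i$ for all $i$; $\mathbf{I}_n$ is the set of these. (In the paper's notation this is $|\mathbf{I}_n(\underline{\leq,>})|$.) -}

module Defs where

open import Data.Nat using (ℕ; zero; suc; _+_; _≤_; _<_; _/_)
open import Data.Nat.Combinatorics using (_C_)
open import Data.Fin using (Fin; toℕ)
open import Data.Vec using (Vec; []; _∷ʳ_; lookup)
open import Data.Product using (∃; _×_)
open import Relation.Nullary using (¬_)
open import Relation.Binary.PropositionalEquality using (_≡_)

-- An inversion sequence of length n: e = e₁ … eₙ with 0 ≤ eᵢ < i,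
-- built by appending entries on the right: the i-th entry lies in Fin i.
-- (An inductive type rather than a function type, so that equality of
--  inversion sequences is structural; no function extensionality needed.)
data InvSeq : ℕ → Set where
  []   : InvSeq zero
  _▷_  : ∀ {n} → InvSeq n → Fin (suc n) → InvSeq (suc n)

toVec : ∀ {n} → InvSeq n → Vec ℕ n
toVec []      = []
toVec (e ▷ x) = toVec e ∷ʳ toℕ x

-- entry at 0-indexed position p, i.e. e_{p+1}
val : ∀ {n} → InvSeq n → Fin n → ℕ
val e p = lookup (toVec e) p

HasPattern : ∀ {n} → InvSeq n → Set
HasPattern {n} e =
  ∃ λ (i : Fin n) → ∃ λ (j : Fin n) → ∃ λ (k : Fin n) →
    (toℕ j ≡ suc (toℕ i)) × (toℕ k ≡ suc (toℕ j)) ×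
    (val e i ≤ val e j) × (val e k < val e j)

-- Catalan number C_n = binom(2n, n) / (n+1)  (exact division)
catalan : ℕ → ℕ
catalan n = ((n + n) C n) / suc n

-- inversion sequences of length n avoiding the consecutive pattern
-- e_i ≤ e_{i+1} > e_{i+2}; the avoidance proof is irrelevant, so two elements
-- are equal iff their underlying inversion sequences are equal
record Avoiding (n : ℕ) : Set where
  constructor avoiding
  field
    seq      : InvSeq n
    .avoids  : ¬ HasPattern seq

module Submission where

-- The proof has three parts.
--  1. Avoidance is monotonicity: an inversion sequence avoids the pattern iff
--     it is weakly increasing.  (Since e₁ = 0 ≤ e₂, a descent anywhere would
--     produce a first descent e_{i+1} > e_{i+2} preceded by e_i ≤ e_{i+1}.)
--     We phrase "weakly increasing with all entries ≤ b" as a predicate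
--     'Rising e b' defined by recursion on the last entry.
--  2. Counting: writing R(n, b) for the weakly increasing inversion sequences
--     of length n with entries ≤ b, splitting on whether the last entry equals
--     b gives R(n+1, b+1) ≅ R(n+1, b) ⊎ R(n, b+1) when b < n, and
--     R(n+1, b+1) ≅ R(n+1, b) otherwise.  This yields explicit bijections
--     R(n, b) ↔ Fin (risingCount n b) for a recursively defined risingCount.
--  3. Arithmetic: the ballot identity risingCount n b + C(n+b, b−1) = C(n+b, b)
--     for b ≤ n, together with n·C(2n, n) = (n+1)·C(2n, n−1), shows
--     risingCount n n = C(2n, n)/(n+1) = catalan n.

open import Defs
open import Data.Nat
open import Data.Nat.Properties
open import Data.Nat.Combinatorics using (_C_; nCk+nC[k+1]≡[n+1]C[k+1]; k>n⇒nCk≡0; nC1≡n; nCk≡nC[n∸k])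
open import Data.Nat.DivMod using (m*n/n≡m)
open import Data.Fin using (Fin; zero; suc; toℕ; fromℕ; fromℕ<; inject₁)
open import Data.Fin.Properties using (toℕ-fromℕ; toℕ-inject₁; toℕ<n; toℕ-fromℕ<; toℕ-injective; +↔⊎)
open import Data.Fin.Relation.Unary.Top using (view; ‵fromℕ; ‵inject₁)
open import Data.Vec using (Vec; []; _∷_; _∷ʳ_; lookup)
open import Data.Product using (_×_; _,_; proj₁; proj₂)
open import Data.Sum using (_⊎_; inj₁; inj₂)
open import Data.Sum.Function.Propositional using (_⊎-↔_)
open import Data.Unit using (⊤; tt)
open import Data.Empty using (⊥-elim)
open import Function.Bundles using (_↔_; mk↔ₛ′)
open import Function.Construct.Composition using (_↔-∘_)
open import Function.Construct.Symmetry using (↔-sym)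
open import Relation.Nullary using (¬_; Dec; yes; no)
open import Relation.Nullary.Decidable using (recompute)
open import Relation.Binary.PropositionalEquality
open import Algebra.Properties.CommutativeSemigroup +-commutativeSemigroup using (interchange)
open ≡-Reasoning

lookup-∷ʳ-last : ∀ {A : Set} {n} (xs : Vec A n) x → lookup (xs ∷ʳ x) (fromℕ n) ≡ x
lookup-∷ʳ-last []       x = refl
lookup-∷ʳ-last (y ∷ xs) x = lookup-∷ʳ-last xs x

lookup-∷ʳ-inject₁ : ∀ {A : Set} {n} (xs : Vec A n) x i → lookup (xs ∷ʳ x) (inject₁ i) ≡ lookup xs i
lookup-∷ʳ-inject₁ (y ∷ xs) x zero    = refl
lookup-∷ʳ-inject₁ (y ∷ xs) x (suc i) = lookup-∷ʳ-inject₁ xs x i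

val-last : ∀ {n} (e : InvSeq n) x → val (e ▷ x) (fromℕ n) ≡ toℕ x
val-last e x = lookup-∷ʳ-last (toVec e) (toℕ x)

val-inject₁ : ∀ {n} (e : InvSeq n) x i → val (e ▷ x) (inject₁ i) ≡ val e i
val-inject₁ e x i = lookup-∷ʳ-inject₁ (toVec e) (toℕ x) i

inject₁-adjacent : ∀ {n} (i j : Fin n) → toℕ j ≡ suc (toℕ i) → toℕ (inject₁ j) ≡ suc (toℕ (inject₁ i))
inject₁-adjacent i j j≡1+i = trans (toℕ-inject₁ j) (trans j≡1+i (cong suc (sym (toℕ-inject₁ i))))

toℕ-inject₁-fromℕ : ∀ m → toℕ (inject₁ (fromℕ m)) ≡ m
toℕ-inject₁-fromℕ m = trans (toℕ-inject₁ (fromℕ m)) (toℕ-fromℕ m)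

-- 'Rising e b': e is weakly increasing and all its entries are ≤ b.
-- Peeling off the last entry x, the rest must be rising with bound x.
Rising : ∀ {n} → InvSeq n → ℕ → Set
Rising []      b = ⊤
Rising (e ▷ x) b = toℕ x ≤ b × Rising e (toℕ x)

rising-weaken : ∀ {n} (e : InvSeq n) {b c} → b ≤ c → Rising e b → Rising e c
rising-weaken []      _   _            = tt
rising-weaken (e ▷ x) b≤c (x≤b , rest) = ≤-trans x≤b b≤c , rest

rising-bounded : ∀ {n} (e : InvSeq n) b → Rising e b → ∀ p → val e p ≤ b
rising-bounded (e ▷ x) b (x≤b , rest) p with view p
... | ‵fromℕ     = subst (_≤ b) (sym (val-last e x)) x≤b
... | ‵inject₁ i = subst (_≤ b) (sym (val-inject₁ e x i)) (≤-trans (rising-bounded e (toℕ x) rest i) x≤b)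

rising-monotone : ∀ {n} (e : InvSeq n) b → Rising e b → ∀ p q → toℕ p ≤ toℕ q → val e p ≤ val e q
rising-monotone {suc n} (e ▷ x) b (_ , rest) p q p≤q with view p | view q
... | ‵fromℕ     | ‵fromℕ     = ≤-refl
... | ‵inject₁ i | ‵fromℕ     =
  subst₂ _≤_ (sym (val-inject₁ e x i)) (sym (val-last e x)) (rising-bounded e (toℕ x) rest i)
... | ‵fromℕ     | ‵inject₁ j =
  ⊥-elim (<⇒≱ (toℕ<n j) (subst₂ _≤_ (toℕ-fromℕ n) (toℕ-inject₁ j) p≤q))
... | ‵inject₁ i | ‵inject₁ j =
  subst₂ _≤_ (sym (val-inject₁ e x i)) (sym (val-inject₁ e x j))
    (rising-monotone e (toℕ x) rest i j (subst₂ _≤_ (toℕ-inject₁ i) (toℕ-inject₁ j) p≤q))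

rising⇒avoids : ∀ {n} (e : InvSeq n) b → Rising e b → ¬ HasPattern e
rising⇒avoids e b r (i , j , k , _ , k≡1+j , _ , k<j) =
  <⇒≱ k<j (rising-monotone e b r j k (subst (toℕ j ≤_) (sym k≡1+j) (n≤1+n _)))

pattern-extends : ∀ {n} (e : InvSeq n) x → HasPattern e → HasPattern (e ▷ x)
pattern-extends e x (i , j , k , j≡1+i , k≡1+j , i≤j , k<j) =
  inject₁ i , inject₁ j , inject₁ k ,
  inject₁-adjacent i j j≡1+i , inject₁-adjacent j k k≡1+j ,
  subst₂ _≤_ (sym (val-inject₁ e x i)) (sym (val-inject₁ e x j)) i≤j ,
  subst₂ _<_ (sym (val-inject₁ e x k)) (sym (val-inject₁ e x j)) k<j

pattern-at-end : ∀ {m} (e : InvSeq m) z y x → toℕ z ≤ toℕ y → toℕ x < toℕ y →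
                 HasPattern (((e ▷ z) ▷ y) ▷ x)
pattern-at-end {m} e z y x z≤y x<y =
  inject₁ (inject₁ (fromℕ m)) , inject₁ (fromℕ (suc m)) , fromℕ (suc (suc m)) ,
  trans (toℕ-inject₁-fromℕ (suc m)) (cong suc (sym (trans (toℕ-inject₁ _) (toℕ-inject₁-fromℕ m)))) ,
  trans (toℕ-fromℕ _) (cong suc (sym (toℕ-inject₁-fromℕ (suc m)))) ,
  subst₂ _≤_ (sym value-z) (sym value-y) z≤y ,
  subst₂ _<_ (sym (val-last ((e ▷ z) ▷ y) x)) (sym value-y) x<y
  where
  value-z : val (((e ▷ z) ▷ y) ▷ x) (inject₁ (inject₁ (fromℕ m))) ≡ toℕ z
  value-z = trans (val-inject₁ ((e ▷ z) ▷ y) x (inject₁ (fromℕ m)))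
                  (trans (val-inject₁ (e ▷ z) y (fromℕ m)) (val-last e z))
  value-y : val (((e ▷ z) ▷ y) ▷ x) (inject₁ (fromℕ (suc m))) ≡ toℕ y
  value-y = trans (val-inject₁ ((e ▷ z) ▷ y) x (fromℕ (suc m))) (val-last (e ▷ z) y)

-- If e is rising and e ▷ x avoids the pattern, then x is at least the last
-- entry of e: otherwise the last two entries of e and x form the pattern
-- (and if e has a single entry, it is 0 ≤ x).
rising-below-last : ∀ {n} (e : InvSeq n) (x : Fin (suc n)) → ¬ HasPattern (e ▷ x) →
                    Rising e n → Rising e (toℕ x)
rising-below-last [] x _ _ = tt
rising-below-last (e ▷ y) x avoids (_ , rest) with toℕ y ≤? toℕ x
... | yes y≤x = y≤x , rest
rising-below-last ([] ▷ zero) x avoids _ | no y≰x = ⊥-elim (y≰x z≤n)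
rising-below-last ((e ▷ z) ▷ y) x avoids (_ , z≤y , _) | no y≰x =
  ⊥-elim (avoids (pattern-at-end e z y x z≤y (≰⇒> y≰x)))

avoids⇒rising : ∀ {n} (e : InvSeq n) → ¬ HasPattern e → Rising e n
avoids⇒rising [] _ = tt
avoids⇒rising {suc n} (e ▷ x) avoids =
  ≤-trans (s≤s⁻¹ (toℕ<n x)) (n≤1+n n) ,
  rising-below-last e x avoids (avoids⇒rising e (λ p → avoids (pattern-extends e x p)))

record RisingSeq (n b : ℕ) : Set where
  constructor risingSeq
  field
    seq     : InvSeq n
    .rising : Rising seq b

avoiding↔rising : ∀ n → Avoiding n ↔ RisingSeq n n
avoiding↔rising n = mk↔ₛ′ (λ { (avoiding e p) → risingSeq e (avoids⇒rising e p) })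
                          (λ { (risingSeq e r) → avoiding e (rising⇒avoids e n r) })
                          (λ _ → refl) (λ _ → refl)

last≤ : ∀ {n b} (e : InvSeq n) x → .(Rising (e ▷ x) b) → toℕ x ≤ b
last≤ {b = b} e x r = recompute (toℕ x ≤? b) (proj₁ r)

risingSeq-cong : ∀ {n b} {e : InvSeq n} {x y : Fin (suc n)} → x ≡ y →
                 .(r : Rising (e ▷ x) b) .(s : Rising (e ▷ y) b) →
                 risingSeq {suc n} {b} (e ▷ x) r ≡ risingSeq (e ▷ y) s
risingSeq-cong refl r s = refl

-- The number of weakly increasing inversion sequences of length n with entries
-- ≤ b, following the case split of the bijections below.
risingCount : ℕ → ℕ → ℕ
risingCount zero    b       = 1
risingCount (suc n) zero    = risingCount n zero
risingCount (suc n) (suc b) with suc b ≤? n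
... | yes _ = risingCount (suc n) b + risingCount n (suc b)
... | no  _ = risingCount (suc n) b

risingCount-zero : ∀ n → risingCount n zero ≡ 1
risingCount-zero zero    = refl
risingCount-zero (suc n) = risingCount-zero n

rising-empty : ∀ b → RisingSeq 0 b ↔ Fin 1
rising-empty b = mk↔ₛ′ (λ _ → zero) (λ _ → risingSeq [] tt) (λ { zero → refl }) (λ { (risingSeq [] _) → refl })

rising-zero : ∀ n → RisingSeq (suc n) 0 ↔ RisingSeq n 0
rising-zero n = mk↔ₛ′ dropLast appendZero (λ _ → refl) restore
  where
  appendZero : RisingSeq n 0 → RisingSeq (suc n) 0
  appendZero (risingSeq e r) = risingSeq (e ▷ zero) (z≤n , r)
  dropLast : RisingSeq (suc n) 0 → RisingSeq n 0
  dropLast (risingSeq (e ▷ x) r) = risingSeq e (subst (Rising e) (n≤0⇒n≡0 (proj₁ r)) (proj₂ r))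
  restore : ∀ s → appendZero (dropLast s) ≡ s
  restore (risingSeq (e ▷ x) r) = risingSeq-cong (toℕ-injective (sym (n≤0⇒n≡0 (last≤ e x r)))) _ r

-- When b ≥ n the bound b+1 is never attained by the last entry (which is ≤ n).
rising-slack : ∀ n b → ¬ (suc b ≤ n) → RisingSeq (suc n) (suc b) ↔ RisingSeq (suc n) b
rising-slack n b b≮n =
  mk↔ₛ′ tighten (λ { (risingSeq e r) → risingSeq e (rising-weaken e (n≤1+n b) r) })
        (λ { (risingSeq (e ▷ x) _) → refl }) (λ { (risingSeq (e ▷ x) _) → refl })
  where
  tighten : RisingSeq (suc n) (suc b) → RisingSeq (suc n) b
  tighten (risingSeq (e ▷ x) r) = risingSeq (e ▷ x) (≤-trans (s≤s⁻¹ (toℕ<n x)) (s≤s⁻¹ (≰⇒> b≮n)) , proj₂ r)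

attains-bound : ∀ {x b} → x ≤ suc b → ¬ x ≤ b → x ≡ suc b
attains-bound x≤1+b x≰b = ≤-antisym x≤1+b (≰⇒> x≰b)

-- When b < n, either the last entry is ≤ b, or it equals b+1 and the remaining
-- prefix is an arbitrary rising sequence with bound b+1.
rising-split : ∀ n b → suc b ≤ n → RisingSeq (suc n) (suc b) ↔ (RisingSeq (suc n) b ⊎ RisingSeq n (suc b))
rising-split n b b<n = mk↔ₛ′ to from to∘from from∘to
  where
  top : Fin (suc n)
  top = fromℕ< (s≤s b<n)
  toℕ-top : toℕ top ≡ suc b
  toℕ-top = toℕ-fromℕ< (s≤s b<n)
  classify : (e : InvSeq n) (x : Fin (suc n)) .(r : Rising (e ▷ x) (suc b)) → Dec (toℕ x ≤ b) →
             RisingSeq (suc n) b ⊎ RisingSeq n (suc b)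
  classify e x r (yes x≤b) = inj₁ (risingSeq (e ▷ x) (x≤b , proj₂ r))
  classify e x r (no x≰b)  = inj₂ (risingSeq e (subst (Rising e) (attains-bound (last≤ e x r) x≰b) (proj₂ r)))
  to : RisingSeq (suc n) (suc b) → RisingSeq (suc n) b ⊎ RisingSeq n (suc b)
  to (risingSeq (e ▷ x) r) = classify e x r (toℕ x ≤? b)
  from : RisingSeq (suc n) b ⊎ RisingSeq n (suc b) → RisingSeq (suc n) (suc b)
  from (inj₁ (risingSeq e r)) = risingSeq e (rising-weaken e (n≤1+n b) r)
  from (inj₂ (risingSeq e r)) = risingSeq (e ▷ top) (≤-reflexive toℕ-top , subst (Rising e) (sym toℕ-top) r)
  from∘to : ∀ s → from (to s) ≡ s
  from∘to (risingSeq (e ▷ x) r) with toℕ x ≤? b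
  ... | yes _   = refl
  ... | no x≰b = risingSeq-cong (toℕ-injective (trans toℕ-top (sym (attains-bound (last≤ e x r) x≰b)))) _ r
  to∘from : ∀ s → to (from s) ≡ s
  to∘from (inj₁ (risingSeq (e ▷ x) r)) with toℕ x ≤? b
  ... | yes _   = refl
  ... | no x≰b = ⊥-elim (x≰b (last≤ e x r))
  to∘from (inj₂ (risingSeq e r)) with toℕ top ≤? b
  ... | yes top≤b = ⊥-elim (<-irrefl refl (subst (_≤ b) toℕ-top top≤b))
  ... | no _      = refl

rising-count : ∀ n b → RisingSeq n b ↔ Fin (risingCount n b)
rising-count zero    b       = rising-empty b
rising-count (suc n) zero    = rising-count n zero ↔-∘ rising-zero n
rising-count (suc n) (suc b) with suc b ≤? n
... | yes b<n = (↔-sym +↔⊎ ↔-∘ (rising-count (suc n) b ⊎-↔ rising-count n (suc b))) ↔-∘ rising-split n b b<n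
... | no  b≮n = rising-count (suc n) b ↔-∘ rising-slack n b b≮n

pascal : ∀ m k → suc m C suc k ≡ m C k + m C suc k
pascal m k = sym (nCk+nC[k+1]≡[n+1]C[k+1] m k)

-- choosePred m b = C(m, b−1), with C(m, −1) = 0.
choosePred : ℕ → ℕ → ℕ
choosePred m zero    = 0
choosePred m (suc b) = m C b

pascal-pred : ∀ m b → suc m C b ≡ choosePred m b + m C b
pascal-pred m zero    = refl
pascal-pred m (suc b) = pascal m b

absorption : ∀ m k → suc k * (suc m C suc k) ≡ suc m * (m C k)
absorption zero zero = refl
absorption zero (suc k) = begin
  suc (suc k) * (1 C suc (suc k)) ≡⟨ cong (suc (suc k) *_) (k>n⇒nCk≡0 {1} {suc (suc k)} (s≤s (s≤s z≤n))) ⟩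
  suc (suc k) * 0                 ≡⟨ *-zeroʳ (suc (suc k)) ⟩
  0                               ≡⟨ cong (1 *_) (k>n⇒nCk≡0 {0} {suc k} (s≤s z≤n)) ⟨
  1 * (0 C suc k)                 ∎
absorption (suc m) zero = begin
  1 * (suc (suc m) C 1) ≡⟨ *-identityˡ _ ⟩
  suc (suc m) C 1       ≡⟨ nC1≡n (suc (suc m)) ⟩
  suc (suc m)           ≡⟨ *-identityʳ _ ⟨
  suc (suc m) * 1       ∎
absorption (suc m) (suc k) = begin
  suc K * (suc M C suc K)                      ≡⟨ cong (suc K *_) (pascal M K) ⟩
  suc K * (M C K + M C suc K)                  ≡⟨ *-distribˡ-+ (suc K) (M C K) _ ⟩
  (M C K + K * (M C K)) + suc K * (M C suc K)  ≡⟨ cong ((M C K + K * (M C K)) +_) (absorption m K) ⟩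
  (M C K + K * (M C K)) + M * (m C K)          ≡⟨ +-assoc (M C K) _ _ ⟩
  M C K + (K * (M C K) + M * (m C K))          ≡⟨ cong (λ t → M C K + (t + M * (m C K))) (absorption m k) ⟩
  M C K + (M * (m C k) + M * (m C K))          ≡⟨ cong (M C K +_) (*-distribˡ-+ M (m C k) _) ⟨
  M C K + M * (m C k + m C K)                  ≡⟨ cong (λ t → M C K + M * t) (pascal m k) ⟨
  M C K + M * (M C K)                          ∎
  where
  M = suc m
  K = suc k

pascal-absorption : ∀ m k → suc k * (m C suc k) + suc k * (m C k) ≡ suc m * (m C k)
pascal-absorption m k = begin
  suc k * (m C suc k) + suc k * (m C k) ≡⟨ +-comm (suc k * (m C suc k)) _ ⟩
  suc k * (m C k) + suc k * (m C suc k) ≡⟨ *-distribˡ-+ (suc k) (m C k) _ ⟨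
  suc k * (m C k + m C suc k)           ≡⟨ cong (suc k *_) (pascal m k) ⟨
  suc k * (suc m C suc k)               ≡⟨ absorption m k ⟩
  suc m * (m C k)                       ∎

-- n·C(2n, n) = (n+1)·C(2n, n−1) for n = k+1: take m = 2n in the identity above
-- and cancel (k+1)·C(2n, k), using 2n+1 = (k+2) + (k+1).
central-ratio : ∀ k → suc k * ((suc k + suc k) C suc k) ≡ suc (suc k) * ((suc k + suc k) C k)
central-ratio k = +-cancelʳ-≡ (suc k * (m C k)) _ _ (begin
  suc k * (m C suc k) + suc k * (m C k) ≡⟨ pascal-absorption m k ⟩
  (suc (suc k) + suc k) * (m C k)       ≡⟨ *-distribʳ-+ (m C k) (suc (suc k)) (suc k) ⟩
  suc (suc k) * (m C k) + suc k * (m C k) ∎)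
  where
  m = suc k + suc k

middle-symmetry : ∀ n → (n + suc n) C suc n ≡ (n + suc n) C n
middle-symmetry n = trans (nCk≡nC[n∸k] (m≤n+m (suc n) n)) (cong ((n + suc n) C_) (m+n∸n≡m n (suc n)))

ballot-step : ∀ m b X Y → X + choosePred m b ≡ m C b → Y + m C b ≡ m C suc b →
              (X + Y) + suc m C b ≡ suc m C suc b
ballot-step m b X Y hX hY = begin
  (X + Y) + suc m C b                     ≡⟨ cong ((X + Y) +_) (pascal-pred m b) ⟩
  (X + Y) + (choosePred m b + m C b)      ≡⟨ interchange X Y (choosePred m b) (m C b) ⟩
  (X + choosePred m b) + (Y + m C b)      ≡⟨ cong₂ _+_ hX hY ⟩
  m C b + m C suc b                       ≡⟨ pascal m b ⟨
  suc m C suc b                           ∎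

-- On the diagonal (bound = length = n+1) the recursion has no second summand,
-- and the symmetry C(2n+1, n+1) = C(2n+1, n) takes its place.
ballot : ∀ n b → b ≤ n → risingCount n b + choosePred (n + b) b ≡ (n + b) C b
ballot zero    zero    _ = refl
ballot (suc n) zero    _ = cong (_+ 0) (risingCount-zero n)
ballot (suc n) (suc b) b<1+n with suc b ≤? n
... | yes b<n = ballot-step (n + suc b) b _ _ shorter-bound (ballot n (suc b) b<n)
  where
  shorter-bound : risingCount (suc n) b + choosePred (n + suc b) b ≡ (n + suc b) C b
  shorter-bound = subst (λ t → risingCount (suc n) b + choosePred t b ≡ t C b) (sym (+-suc n b))
                        (ballot (suc n) b (≤-trans (n≤1+n b) b<1+n))
... | no b≮n with ≤-antisym (s≤s⁻¹ b<1+n) (≮⇒≥ b≮n)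
... | refl = subst (λ t → t + (suc m C n) ≡ suc m C suc n) (+-identityʳ (risingCount (suc n) n))
               (ballot-step m n _ 0 shorter-bound (sym (middle-symmetry n)))
  where
  m = n + suc n
  shorter-bound : risingCount (suc n) n + choosePred m n ≡ m C n
  shorter-bound = subst (λ t → risingCount (suc n) n + choosePred t n ≡ t C n) (sym (+-suc n n))
                        (ballot (suc n) n (n≤1+n n))

-- catalan n = risingCount n n: with c = risingCount n n, A = C(2n, n) and
-- B = C(2n, n−1), the ballot identity c + B = A and n·A = (n+1)·B give
-- (n+1)·c = A, so A/(n+1) = c.
catalan≡risingCount : ∀ n → 1 ≤ n → catalan n ≡ risingCount n n
catalan≡risingCount (suc k) _ = trans (cong (_/ suc n) (sym times-succ)) (m*n/n≡m c (suc n))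
  where
  n = suc k
  A = (n + n) C n
  B = (n + n) C k
  c = risingCount n n
  times-succ : c * suc n ≡ A
  times-succ = +-cancelʳ-≡ (suc n * B) _ _ (begin
    c * suc n + suc n * B ≡⟨ cong (_+ suc n * B) (*-comm c (suc n)) ⟩
    suc n * c + suc n * B ≡⟨ *-distribˡ-+ (suc n) c B ⟨
    suc n * (c + B)       ≡⟨ cong (suc n *_) (ballot n n ≤-refl) ⟩
    A + n * A             ≡⟨ cong (A +_) (central-ratio k) ⟩
    A + suc n * B         ∎)

proposition4p17 : (n : ℕ) → 1 ≤ n → Avoiding n ↔ Fin (catalan n)
proposition4p17 n 1≤n =
  subst (λ size → Avoiding n ↔ Fin size) (sym (catalan≡risingCount n 1≤n))
        (rising-count n n ↔-∘ avoiding↔rising n)
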